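{- For every integer $n\ge 1$, the set of Dumont permutations of the first kind of length $2n$ avoiding both $231$ and $4213$ is $\mathfrak D^1_{2n}(231,4213)=\{(2,1,4,3,\dots,2n,2n-1)\}$ (in one-line notation).
   Context: A permutation $\sigma\in\mathfrak S_m$ contains a pattern $\tau\in\mathfrak S_k$ if $\sigma$ has a subsequence $(\sigma(i_1),\dots,\sigma(i_k))$, $i_1<\dots<i_k$, order-isomorphic to $\tau$; otherwise $\sigma$ avoids $\tau$. A Dumont permutation of the first kind of length $2n$ is a permutation $\pi\in\mathfrak S_{2n}$ such that for every $i$: if $\pi(i)$ is even then $i<2n$ and $\pi(i)>\pi(i+1)$; if $\pi(i)$ is odd then $i=2n$ or $\pi(i)<\pi(i+1)$. $\mathfrak D^1_{2n}(T)$ denotes the set of such permutations avoiding every pattern in $T$. -}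

module Defs where

open import Data.Nat as ℕ using (ℕ; zero; suc; _*_)
open import Data.Nat.Divisibility using (_∣_)
open import Data.Fin as Fin using (Fin; toℕ; #_)
open import Data.Vec using (Vec; []; _∷_; lookup)
open import Data.Product using (Σ; ∃; _×_)
open import Data.Sum using (_⊎_)
open import Relation.Nullary using (¬_)
open import Relation.Binary.PropositionalEquality using (_≡_)
open import Function.Bundles using (_⇔_)
open import Function.Definitions using (Injective)

-- A permutation of length m (one-line notation, 0-based values:
-- Fin value v stands for the integer v+1).
IsPerm : {m : ℕ} → (Fin m → Fin m) → Set
IsPerm π = Injective _≡_ _≡_ π

Contains : {m k : ℕ} → (Fin m → Fin m) → (Fin k → Fin k) → Set
Contains {m} {k} σ τ =
  Σ (Fin k → Fin m) λ ι →
    (∀ a b → a Fin.< b → ι a Fin.< ι b) ×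
    (∀ a b → (σ (ι a) Fin.< σ (ι b)) ⇔ (τ a Fin.< τ b))

Avoids : {m k : ℕ} → (Fin m → Fin m) → (Fin k → Fin k) → Set
Avoids σ τ = ¬ Contains σ τ

p231 : Fin 3 → Fin 3
p231 = lookup (# 1 ∷ # 2 ∷ # 0 ∷ [])

p4213 : Fin 4 → Fin 4
p4213 = lookup (# 3 ∷ # 1 ∷ # 0 ∷ # 2 ∷ [])

val : {m : ℕ} → (Fin m → Fin m) → Fin m → ℕ
val π i = suc (toℕ (π i))

-- Dumont permutation of the first kind of length m (positions 0-based:
-- position i is last iff suc (toℕ i) ≡ m).
IsDumont1 : {m : ℕ} → (Fin m → Fin m) → Set
IsDumont1 {m} π =
  (∀ i → 2 ∣ val π i →
     Σ (Fin m) λ j → (toℕ j ≡ suc (toℕ i)) × (π j Fin.< π i)) ×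
  (∀ i → ¬ (2 ∣ val π i) →
     (suc (toℕ i) ≡ m) ⊎ (Σ (Fin m) λ j → (toℕ j ≡ suc (toℕ i)) × (π i Fin.< π j)))

InD1-231-4213 : (n : ℕ) → (Fin (2 * n) → Fin (2 * n)) → Set
InD1-231-4213 n π = IsPerm π × IsDumont1 π × Avoids π p231 × Avoids π p4213

-- 0-based one-line notation of (2,1,4,3,...): position i ↦ value swapAdj i
swapAdj : ℕ → ℕ
swapAdj zero = 1
swapAdj (suc zero) = 0
swapAdj (suc (suc i)) = suc (suc (swapAdj i))

{-# OPTIONS --safe #-}
module Submission where

-- Read the permutation from the right (values and positions 1-based). Suppose the
-- positions after 2k+2 already carry the adjacent transpositions, so that positions
-- 1, …, 2k+2 carry the values 1, …, 2k+2. Being even, the maximum 2k+2 of this block is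
-- followed by a smaller value a, hence lies at position 2k+1 or earlier. Suppose it lies
-- earlier and let b be the value after a. Avoiding 231 puts a+1, if it is not 2k+2, to the
-- right of a. If b < a, then a is even, so a+1 < 2k+2 and 2k+2, a, b, a+1 form a 4213.
-- If b > a, then a is odd, a+1 = 2k+2 would leave no room for b, and the even a+1 is
-- followed by some c < a, so a, b, c form a 231. Hence 2k+2 is at position 2k+1, and
-- 2k+1 comes right after it: otherwise 2k+1 precedes 2k+2, and together with the value at
-- position 2k+2 they form a 231.

open import Defs
open import Data.Nat using (ℕ; zero; suc; _*_; _+_; _≤_; _<_; z≤n; s≤s; z<s; s<s)
open import Data.Nat.Properties
  using (_≟_; _<?_; <-cmp; <-irrefl; <-asym; <-trans; <-≤-trans; ≤-antisym; ≤-pred; ≤∧≢⇒<;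
         ≮⇒≥; <⇒≱; ≤⇒≯; n<1+n; 1+n≢n; m≤n+m; +-suc; +-identityʳ; *-suc)
open import Data.Nat.Divisibility using (_∣_; _∣?_; divides; ∣-refl; ∣1⇒≡1; ∣m∣n⇒∣m+n; ∣m+n∣m⇒∣n)
open import Data.Fin using (Fin; zero; suc; toℕ; fromℕ<; inject₁; punchOut; #_)
import Data.Fin as Fin
open import Data.Fin.Properties
  using (toℕ-injective; toℕ-fromℕ<; toℕ<n; any?; punchOut-injective; injective⇒≤)
open import Data.Vec using ([]; _∷_; lookup)
open import Data.Product using (∃; _×_; _,_; proj₁; proj₂)
open import Data.Sum using (_⊎_; inj₁; inj₂)
open import Data.Empty using (⊥; ⊥-elim)
open import Relation.Nullary using (¬_; yes; no; contradiction)
open import Relation.Binary.Definitions using (tri<; tri≈; tri>)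
open import Relation.Binary.PropositionalEquality
  using (_≡_; _≢_; refl; sym; trans; cong; subst; subst₂)
open import Function using (_∘_)
open import Function.Bundles using (_⇔_; mk⇔; Equivalence)
open import Function.Definitions using (Injective)

double : ℕ → ℕ
double zero = zero
double (suc n) = suc (suc (double n))

double≡2* : ∀ n → double n ≡ 2 * n
double≡2* zero = refl
double≡2* (suc n) = trans (cong (2 +_) (double≡2* n)) (sym (*-suc 2 n))

double-mono : ∀ {k n} → k ≤ n → double k ≤ double n
double-mono z≤n = z≤n
double-mono (s≤s k≤n) = s≤s (s≤s (double-mono k≤n))

≡suc⇒> : ∀ {x y} → x ≡ suc y → y < x
≡suc⇒> refl = n<1+n _

2∤1 : ¬ 2 ∣ 1
2∤1 2∣1 with ∣1⇒≡1 2∣1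
... | ()

2∣2+n : ∀ {n} → 2 ∣ n → 2 ∣ suc (suc n)
2∣2+n = ∣m∣n⇒∣m+n ∣-refl

2∣2+n⇒2∣n : ∀ {n} → 2 ∣ suc (suc n) → 2 ∣ n
2∣2+n⇒2∣n 2∣2+n = ∣m+n∣m⇒∣n 2∣2+n ∣-refl

2∣n⇒2∤1+n : ∀ {n} → 2 ∣ n → ¬ 2 ∣ suc n
2∣n⇒2∤1+n {zero} _ = 2∤1
2∣n⇒2∤1+n {suc zero} 2∣1 = ⊥-elim (2∤1 2∣1)
2∣n⇒2∤1+n {suc (suc n)} 2∣2+n 2∣3+n = 2∣n⇒2∤1+n (2∣2+n⇒2∣n 2∣2+n) (2∣2+n⇒2∣n 2∣3+n)

2∤n⇒2∣1+n : ∀ {n} → ¬ 2 ∣ n → 2 ∣ suc n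
2∤n⇒2∣1+n {zero} 2∤0 = ⊥-elim (2∤0 (divides 0 refl))
2∤n⇒2∣1+n {suc zero} _ = ∣-refl
2∤n⇒2∣1+n {suc (suc n)} 2∤2+n = 2∣2+n (2∤n⇒2∣1+n (2∤2+n ∘ 2∣2+n))

2∣double : ∀ k → 2 ∣ double k
2∣double zero = divides 0 refl
2∣double (suc k) = 2∣2+n (2∣double k)

2∤1+double : ∀ k → ¬ 2 ∣ suc (double k)
2∤1+double k = 2∣n⇒2∤1+n (2∣double k)

swapAdj-involutive : ∀ x → swapAdj (swapAdj x) ≡ x
swapAdj-involutive zero = refl
swapAdj-involutive (suc zero) = refl
swapAdj-involutive (suc (suc x)) = cong (2 +_) (swapAdj-involutive x)

swapAdj-injective : ∀ {x y} → swapAdj x ≡ swapAdj y → x ≡ y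
swapAdj-injective {x} {y} eq =
  trans (sym (swapAdj-involutive x)) (trans (cong swapAdj eq) (swapAdj-involutive y))

swapAdj-double : ∀ k → swapAdj (double k) ≡ suc (double k)
swapAdj-double zero = refl
swapAdj-double (suc k) = cong (2 +_) (swapAdj-double k)

swapAdj-1+double : ∀ k → swapAdj (suc (double k)) ≡ double k
swapAdj-1+double zero = refl
swapAdj-1+double (suc k) = cong (2 +_) (swapAdj-1+double k)

double≤swapAdj : ∀ k {x} → double k ≤ x → double k ≤ swapAdj x
double≤swapAdj zero _ = z≤n
double≤swapAdj (suc k) {suc (suc x)} (s≤s (s≤s 2k≤x)) = s≤s (s≤s (double≤swapAdj k 2k≤x))

swapAdj<double : ∀ k {x} → x < double k → swapAdj x < double k
swapAdj<double (suc k) {zero} _ = s<s (s<s z≤n)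
swapAdj<double (suc k) {suc zero} _ = z<s
swapAdj<double (suc k) {suc (suc x)} (s<s (s<s x<2k)) = s<s (s<s (swapAdj<double k x<2k))

swapAdj-inversion⇒adjacent : ∀ {x y} → x < y → swapAdj y < swapAdj x → y ≡ suc x
swapAdj-inversion⇒adjacent {zero} {suc zero} _ _ = refl
swapAdj-inversion⇒adjacent {zero} {suc (suc y)} _ (s<s ())
swapAdj-inversion⇒adjacent {suc zero} {_} _ ()
swapAdj-inversion⇒adjacent {suc (suc x)} {suc (suc y)} (s<s (s<s x<y)) (s<s (s<s inv)) =
  cong (2 +_) (swapAdj-inversion⇒adjacent x<y inv)

swapAdj-descent : ∀ n x → x < double n → 2 ∣ suc (swapAdj x) →
  suc x < double n × swapAdj (suc x) < swapAdj x
swapAdj-descent (suc n) zero _ _ = s<s (s<s z≤n) , z<s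
swapAdj-descent (suc n) (suc zero) _ 2∣1 = ⊥-elim (2∤1 2∣1)
swapAdj-descent (suc n) (suc (suc x)) (s<s (s<s x<2n)) even =
  let (x+1<2n , desc) = swapAdj-descent n x x<2n (2∣2+n⇒2∣n even)
  in s<s (s<s x+1<2n) , s<s (s<s desc)

swapAdj-ascent : ∀ n x → x < double n → ¬ 2 ∣ suc (swapAdj x) →
  suc x ≡ double n ⊎ (suc x < double n × swapAdj x < swapAdj (suc x))
swapAdj-ascent (suc n) zero _ odd = ⊥-elim (odd ∣-refl)
swapAdj-ascent (suc zero) (suc zero) _ _ = inj₁ refl
swapAdj-ascent (suc (suc n)) (suc zero) _ _ = inj₂ (s<s (s<s z<s) , z<s)
swapAdj-ascent (suc n) (suc (suc x)) (s<s (s<s x<2n)) odd with swapAdj-ascent n x x<2n (odd ∘ 2∣2+n)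
... | inj₁ last = inj₁ (cong (2 +_) last)
... | inj₂ (x+1<2n , asc) = inj₂ (s<s (s<s x+1<2n) , s<s (s<s asc))

Ascending : ∀ {k} → (Fin (suc k) → ℕ) → Set
Ascending {k} f = ∀ (a : Fin k) → f (inject₁ a) < f (suc a)

ascending⇒increasing : ∀ {k} {f : Fin (suc k) → ℕ} → Ascending f →
  ∀ {a b} → a Fin.< b → f a < f b
ascending⇒increasing {suc k} asc {zero} {suc zero} _ = asc zero
ascending⇒increasing {suc k} {f} asc {zero} {suc (suc b)} _ =
  <-trans (asc zero) (ascending⇒increasing {f = f ∘ suc} (asc ∘ suc) {zero} {suc b} z<s)
ascending⇒increasing {suc k} {f} asc {suc a} {suc b} (s<s a<b) =
  ascending⇒increasing {f = f ∘ suc} (asc ∘ suc) a<b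

contains-by-listing : ∀ {m k} (σ : Fin m → Fin m) {τ τ⁻¹ : Fin (suc k) → Fin (suc k)} →
  (∀ a → τ⁻¹ (τ a) ≡ a) → (ι : Fin (suc k) → Fin m) →
  Ascending (toℕ ∘ ι) → Ascending (toℕ ∘ σ ∘ ι ∘ τ⁻¹) → Contains σ τ
contains-by-listing σ {τ} {τ⁻¹} τ⁻¹∘τ≗id ι ι↑ σι↑ =
  ι , (λ _ _ → ascending⇒increasing {f = toℕ ∘ ι} ι↑) , λ a b → mk⇔ (reflect a b) (preserve a b)
  where
  preserve : ∀ a b → τ a Fin.< τ b → σ (ι a) Fin.< σ (ι b)
  preserve a b τa<τb =
    subst₂ (λ x y → σ (ι x) Fin.< σ (ι y)) (τ⁻¹∘τ≗id a) (τ⁻¹∘τ≗id b)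
      (ascending⇒increasing {f = toℕ ∘ σ ∘ ι ∘ τ⁻¹} σι↑ τa<τb)
  reflect : ∀ a b → σ (ι a) Fin.< σ (ι b) → τ a Fin.< τ b
  reflect a b σιa<σιb with <-cmp (toℕ (τ a)) (toℕ (τ b))
  ... | tri< τa<τb _ _ = τa<τb
  ... | tri≈ _ τa≡τb _ = contradiction σιa<σιb (<-irrefl (cong (toℕ ∘ σ ∘ ι) a≡b))
    where
    a≡b : a ≡ b
    a≡b = trans (sym (τ⁻¹∘τ≗id a)) (trans (cong τ⁻¹ (toℕ-injective τa≡τb)) (τ⁻¹∘τ≗id b))
  ... | tri> _ _ τb<τa = contradiction σιa<σιb (<-asym (preserve b a τb<τa))

contains231 : ∀ {m} (σ : Fin m → Fin m) {i j l : Fin m} →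
  toℕ i < toℕ j → toℕ j < toℕ l →
  toℕ (σ l) < toℕ (σ i) → toℕ (σ i) < toℕ (σ j) → Contains σ p231
contains231 σ {i} {j} {l} i<j j<l σl<σi σi<σj =
  contains-by-listing σ {τ⁻¹ = lookup (# 2 ∷ # 0 ∷ # 1 ∷ [])}
    (λ { zero → refl ; (suc zero) → refl ; (suc (suc zero)) → refl })
    (lookup (i ∷ j ∷ l ∷ []))
    (λ { zero → i<j ; (suc zero) → j<l })
    (λ { zero → σl<σi ; (suc zero) → σi<σj })

contains4213 : ∀ {m} (σ : Fin m → Fin m) {i j l r : Fin m} →
  toℕ i < toℕ j → toℕ j < toℕ l → toℕ l < toℕ r →
  toℕ (σ l) < toℕ (σ j) → toℕ (σ j) < toℕ (σ r) → toℕ (σ r) < toℕ (σ i) → Contains σ p4213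
contains4213 σ {i} {j} {l} {r} i<j j<l l<r σl<σj σj<σr σr<σi =
  contains-by-listing σ {τ⁻¹ = lookup (# 2 ∷ # 1 ∷ # 3 ∷ # 0 ∷ [])}
    (λ { zero → refl ; (suc zero) → refl ; (suc (suc zero)) → refl
       ; (suc (suc (suc zero))) → refl })
    (lookup (i ∷ j ∷ l ∷ r ∷ []))
    (λ { zero → i<j ; (suc zero) → j<l ; (suc (suc zero)) → l<r })
    (λ { zero → σl<σj ; (suc zero) → σj<σr ; (suc (suc zero)) → σr<σi })

module _ {m} {π : Fin m → Fin m} (π≗swapAdj : ∀ i → toℕ (π i) ≡ swapAdj (toℕ i)) where

  swapAdj-isPerm : IsPerm π
  swapAdj-isPerm {i} {j} πi≡πj = toℕ-injective (swapAdj-injective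
    (trans (sym (π≗swapAdj i)) (trans (cong toℕ πi≡πj) (π≗swapAdj j))))

  private
    inversion⇒adjacent : ∀ {i j} → toℕ i < toℕ j → π j Fin.< π i → toℕ j ≡ suc (toℕ i)
    inversion⇒adjacent {i} {j} i<j πj<πi =
      swapAdj-inversion⇒adjacent i<j (subst₂ _<_ (π≗swapAdj j) (π≗swapAdj i) πj<πi)

  swapAdj-avoids231 : Avoids π p231
  swapAdj-avoids231 (ι , ι↑ , order) =
    <⇒≱ ι₀<ι₁ (≤-pred (subst (toℕ (ι (# 1)) <_) ι₂≡1+ι₀ ι₁<ι₂))
    where
    ι₀<ι₁ : toℕ (ι (# 0)) < toℕ (ι (# 1))
    ι₀<ι₁ = ι↑ (# 0) (# 1) z<s
    ι₁<ι₂ : toℕ (ι (# 1)) < toℕ (ι (# 2))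
    ι₁<ι₂ = ι↑ (# 1) (# 2) (s<s z<s)
    ι₂≡1+ι₀ : toℕ (ι (# 2)) ≡ suc (toℕ (ι (# 0)))
    ι₂≡1+ι₀ = inversion⇒adjacent (ι↑ (# 0) (# 2) z<s) (Equivalence.from (order (# 2) (# 0)) z<s)

  swapAdj-avoids4213 : Avoids π p4213
  swapAdj-avoids4213 (ι , ι↑ , order) =
    <-irrefl (trans ι₁≡1+ι₀ (sym ι₂≡1+ι₀)) (ι↑ (# 1) (# 2) (s<s z<s))
    where
    ι₁≡1+ι₀ : toℕ (ι (# 1)) ≡ suc (toℕ (ι (# 0)))
    ι₁≡1+ι₀ =
      inversion⇒adjacent (ι↑ (# 0) (# 1) z<s) (Equivalence.from (order (# 1) (# 0)) (s<s z<s))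
    ι₂≡1+ι₀ : toℕ (ι (# 2)) ≡ suc (toℕ (ι (# 0)))
    ι₂≡1+ι₀ = inversion⇒adjacent (ι↑ (# 0) (# 2) z<s) (Equivalence.from (order (# 2) (# 0)) z<s)

  swapAdj-isDumont1 : ∀ {n} → m ≡ double n → IsDumont1 π
  swapAdj-isDumont1 {n} m≡double = descents , ascents
    where
    bound : ∀ i → toℕ i < double n
    bound i = subst (toℕ i <_) m≡double (toℕ<n i)
    successor : ∀ i → suc (toℕ i) < double n →
      ∃ λ j → toℕ j ≡ suc (toℕ i) × toℕ (π j) ≡ swapAdj (suc (toℕ i))
    successor i i+1<2n =
      j , toℕ-fromℕ< i+1<m , trans (π≗swapAdj j) (cong swapAdj (toℕ-fromℕ< i+1<m))
      where
      i+1<m : suc (toℕ i) < m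
      i+1<m = subst (suc (toℕ i) <_) (sym m≡double) i+1<2n
      j : Fin m
      j = fromℕ< i+1<m
    descents : ∀ i → 2 ∣ val π i → ∃ λ j → toℕ j ≡ suc (toℕ i) × π j Fin.< π i
    descents i even =
      let (i+1<2n , desc) =
            swapAdj-descent n (toℕ i) (bound i) (subst (λ v → 2 ∣ suc v) (π≗swapAdj i) even)
          (j , j≡1+i , πj≡) = successor i i+1<2n
      in j , j≡1+i , subst₂ _<_ (sym πj≡) (sym (π≗swapAdj i)) desc
    ascents : ∀ i → ¬ 2 ∣ val π i →
      suc (toℕ i) ≡ m ⊎ ∃ λ j → toℕ j ≡ suc (toℕ i) × π i Fin.< π j
    ascents i odd
      with swapAdj-ascent n (toℕ i) (bound i) (odd ∘ subst (λ v → 2 ∣ suc v) (sym (π≗swapAdj i)))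
    ... | inj₁ last = inj₁ (trans last (sym m≡double))
    ... | inj₂ (i+1<2n , asc) =
      let (j , j≡1+i , πj≡) = successor i i+1<2n
      in inj₂ (j , j≡1+i , subst₂ _<_ (sym (π≗swapAdj i)) (sym πj≡) asc)

AgreesFrom : ∀ {m} → (Fin m → Fin m) → ℕ → Set
AgreesFrom π K = ∀ i → K ≤ toℕ i → toℕ (π i) ≡ swapAdj (toℕ i)

PrefixInvariant : ∀ {m} → (Fin m → Fin m) → ℕ → Set
PrefixInvariant π K = ∀ i → toℕ i < K ⇔ toℕ (π i) < K

agreesFrom-extend : ∀ {m} {π : Fin m → Fin m} k →
  (∀ i → toℕ i ≡ double k → toℕ (π i) ≡ suc (double k)) →
  (∀ i → toℕ i ≡ suc (double k) → toℕ (π i) ≡ double k) →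
  AgreesFrom π (double (suc k)) → AgreesFrom π (double k)
agreesFrom-extend k at-2k at-2k+1 agrees i 2k≤i with toℕ i ≟ double k | toℕ i ≟ suc (double k)
... | yes i≡2k | _ = trans (at-2k i i≡2k) (sym (trans (cong swapAdj i≡2k) (swapAdj-double k)))
... | no _ | yes i≡2k+1 =
  trans (at-2k+1 i i≡2k+1) (sym (trans (cong swapAdj i≡2k+1) (swapAdj-1+double k)))
... | no i≢2k | no i≢2k+1 = agrees i (≤∧≢⇒< (≤∧≢⇒< 2k≤i (i≢2k ∘ sym)) (i≢2k+1 ∘ sym))

agreesFrom⇒prefixInvariant : ∀ {m n k} {π : Fin m → Fin m} → m ≡ double n → IsPerm π →
  AgreesFrom π (double k) → PrefixInvariant π (double k)
agreesFrom⇒prefixInvariant {m} {n} {k} {π} m≡double π-injective agrees i = mk⇔ to from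
  where
  from : toℕ (π i) < double k → toℕ i < double k
  from πi<2k with toℕ i <? double k
  ... | yes i<2k = i<2k
  ... | no i≮2k = contradiction πi<2k (≤⇒≯ 2k≤πi)
    where
    2k≤i : double k ≤ toℕ i
    2k≤i = ≮⇒≥ i≮2k
    2k≤πi : double k ≤ toℕ (π i)
    2k≤πi = subst (double k ≤_) (sym (agrees i 2k≤i)) (double≤swapAdj k 2k≤i)
  -- A value v ≥ 2k already sits at position swapAdj v, so it cannot sit at i < 2k.
  to : toℕ i < double k → toℕ (π i) < double k
  to i<2k with toℕ (π i) <? double k
  ... | yes πi<2k = πi<2k
  ... | no πi≮2k = contradiction i<2k (≤⇒≯ (subst (double k ≤_) j≡i 2k≤j))
    where
    2k≤πi : double k ≤ toℕ (π i)
    2k≤πi = ≮⇒≥ πi≮2k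
    j<m : swapAdj (toℕ (π i)) < m
    j<m = subst (swapAdj (toℕ (π i)) <_) (sym m≡double)
                (swapAdj<double n (subst (toℕ (π i) <_) m≡double (toℕ<n (π i))))
    j : Fin m
    j = fromℕ< j<m
    2k≤j : double k ≤ toℕ j
    2k≤j = subst (double k ≤_) (sym (toℕ-fromℕ< j<m)) (double≤swapAdj k 2k≤πi)
    j≡i : toℕ j ≡ toℕ i
    j≡i = cong toℕ (π-injective (toℕ-injective πj≡πi))
      where
      πj≡πi : toℕ (π j) ≡ toℕ (π i)
      πj≡πi = trans (agrees j 2k≤j)
                    (trans (cong swapAdj (toℕ-fromℕ< j<m)) (swapAdj-involutive (toℕ (π i))))

injective⇒surjective : ∀ {m} {f : Fin m → Fin m} → Injective _≡_ _≡_ f → ∀ v → ∃ λ i → f i ≡ v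
injective⇒surjective {suc m} {f} f-injective v with any? (λ i → f i Fin.≟ v)
... | yes hit = hit
... | no miss = contradiction (injective⇒≤ g-injective) (<-irrefl refl)
  where
  g : Fin (suc m) → Fin m
  g i = punchOut (λ v≡fi → miss (i , sym v≡fi))
  g-injective : Injective _≡_ _≡_ g
  g-injective {x} {y} = f-injective ∘ punchOut-injective {i = v}
    (λ v≡fx → miss (x , sym v≡fx)) (λ v≡fy → miss (y , sym v≡fy))

module Avoiding {m} {π : Fin m → Fin m} (π-injective : IsPerm π) (π-dumont : IsDumont1 π)
                (avoids231 : Avoids π p231) (avoids4213 : Avoids π p4213) where

  value : Fin m → ℕ
  value i = toℕ (π i)

  value-injective : ∀ {i j} → value i ≡ value j → i ≡ j
  value-injective = π-injective ∘ toℕ-injective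

  value-cong : ∀ {i j} → toℕ i ≡ toℕ j → value i ≡ value j
  value-cong = cong value ∘ toℕ-injective

  no231 : ∀ {i j l} → toℕ i < toℕ j → toℕ j < toℕ l →
    value l < value i → value i < value j → ⊥
  no231 i<j j<l vl<vi vi<vj = avoids231 (contains231 π i<j j<l vl<vi vi<vj)

  no4213 : ∀ {i j l r} → toℕ i < toℕ j → toℕ j < toℕ l → toℕ l < toℕ r →
    value l < value j → value j < value r → value r < value i → ⊥
  no4213 i<j j<l l<r vl<vj vj<vr vr<vi = avoids4213 (contains4213 π i<j j<l l<r vl<vj vj<vr vr<vi)

  between⇒right : ∀ {p j r} → toℕ p < toℕ j → value j < value r → value r < value p → toℕ p < toℕ r
  between⇒right {p} {j} {r} p<j vj<vr vr<vp with <-cmp (toℕ r) (toℕ p)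
  ... | tri< r<p _ _ = ⊥-elim (no231 r<p p<j vj<vr vr<vp)
  ... | tri≈ _ r≡p _ = ⊥-elim (<-irrefl (value-cong r≡p) vr<vp)
  ... | tri> _ _ p<r = p<r

  position : ∀ v → v < m → Fin m
  position v v<m = proj₁ (injective⇒surjective π-injective (fromℕ< v<m))

  value-position : ∀ {v} (v<m : v < m) → value (position v v<m) ≡ v
  value-position v<m =
    trans (cong toℕ (proj₂ (injective⇒surjective π-injective (fromℕ< v<m)))) (toℕ-fromℕ< v<m)

  descent : ∀ i → 2 ∣ suc (value i) → ∃ λ j → toℕ j ≡ suc (toℕ i) × value j < value i
  descent = proj₁ π-dumont

  ascent : ∀ i → ¬ 2 ∣ suc (value i) → suc (toℕ i) < m →
    ∃ λ j → toℕ j ≡ suc (toℕ i) × value i < value j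
  ascent i odd i+1<m with proj₂ π-dumont i odd
  ... | inj₁ last = ⊥-elim (<-irrefl last i+1<m)
  ... | inj₂ next = next

  no-ascent-before-successor : ∀ {j₁ j₂ r} → toℕ j₂ ≡ suc (toℕ j₁) → toℕ j₁ < toℕ r →
    value r ≡ suc (value j₁) → 2 ∣ suc (value r) → value j₁ < value j₂ → ⊥
  no-ascent-before-successor {j₁} {j₂} {r} j₂≡1+j₁ j₁<r vr≡1+vj₁ even vj₁<vj₂ =
    let (j′ , j′≡1+r , vj′<vr) = descent r even
        j₂<j′ = subst₂ _<_ (sym j₂≡1+j₁) (sym j′≡1+r) (s<s j₁<r)
        vj′≢vj₁ : value j′ ≢ value j₁
        vj′≢vj₁ = λ e →
          <-irrefl (cong toℕ (sym (value-injective e))) (<-trans (≡suc⇒> j₂≡1+j₁) j₂<j′)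
        vj′<vj₁ = ≤∧≢⇒< (≤-pred (subst (value j′ <_) vr≡1+vj₁ vj′<vr)) vj′≢vj₁
    in no231 (≡suc⇒> j₂≡1+j₁) j₂<j′ vj′<vj₁ vj₁<vj₂

  module Block (k : ℕ) (K≤m : suc (suc (double k)) ≤ m)
               (invariant : PrefixInvariant π (suc (suc (double k)))) where

    top : ℕ
    top = suc (double k)

    top<m : top < m
    top<m = K≤m

    value<K : ∀ i → toℕ i < suc top → value i < suc top
    value<K i = Equivalence.to (invariant i)

    index<K : ∀ i → value i < suc top → toℕ i < suc top
    index<K i = Equivalence.from (invariant i)

    successor-position : ∀ {p j} → value p ≡ top → toℕ j ≡ suc (toℕ p) → suc (value j) < top →
      ∃ λ r → value r ≡ suc (value j) × toℕ j < toℕ r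
    successor-position {p} {j} vp≡top j≡1+p 1+vj<top =
      r , vr≡1+vj , ≤∧≢⇒< (subst (_≤ toℕ r) (sym j≡1+p) p<r) j≢r
      where
      1+vj<m : suc (value j) < m
      1+vj<m = <-trans 1+vj<top top<m
      r : Fin m
      r = position (suc (value j)) 1+vj<m
      vr≡1+vj : value r ≡ suc (value j)
      vr≡1+vj = value-position 1+vj<m
      p<r : toℕ p < toℕ r
      p<r = between⇒right (≡suc⇒> j≡1+p) (subst (value j <_) (sym vr≡1+vj) (n<1+n (value j)))
                          (subst₂ _<_ (sym vr≡1+vj) (sym vp≡top) 1+vj<top)
      j≢r : toℕ j ≢ toℕ r
      j≢r j≡r = 1+n≢n (sym (trans (value-cong j≡r) vr≡1+vj))

    no-descent-after-top : ∀ {p j₁ j₂} →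
      value p ≡ top → toℕ j₁ ≡ suc (toℕ p) → toℕ j₂ ≡ suc (toℕ j₁) →
      value j₁ < top → 2 ∣ suc (value j₁) → value j₂ < value j₁ → ⊥
    no-descent-after-top {p} {j₁} {j₂} vp≡top j₁≡1+p j₂≡1+j₁ vj₁<top even vj₂<vj₁ =
      let (r , vr≡1+vj₁ , j₁<r) = successor-position vp≡top j₁≡1+p 1+vj₁<top
          vj₁<vr = subst (value j₁ <_) (sym vr≡1+vj₁) (n<1+n (value j₁))
          j₂≢r : toℕ j₂ ≢ toℕ r
          j₂≢r = λ j₂≡r → <-asym vj₂<vj₁ (subst (value j₁ <_) (sym (value-cong j₂≡r)) vj₁<vr)
          j₂<r = ≤∧≢⇒< (subst (_≤ toℕ r) (sym j₂≡1+j₁) j₁<r) j₂≢r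
      in no4213 (≡suc⇒> j₁≡1+p) (≡suc⇒> j₂≡1+j₁) j₂<r vj₂<vj₁ vj₁<vr
                (subst₂ _<_ (sym vr≡1+vj₁) (sym vp≡top) 1+vj₁<top)
      where
      1+vj₁<top : suc (value j₁) < top
      1+vj₁<top = ≤∧≢⇒< vj₁<top (λ 1+vj₁≡top → 2∤1+double k (subst (2 ∣_) 1+vj₁≡top even))

    no-ascent-after-top : ∀ {p j₁ j₂} →
      value p ≡ top → toℕ j₁ ≡ suc (toℕ p) → toℕ j₂ ≡ suc (toℕ j₁) →
      toℕ j₂ < suc top → value j₁ < top → ¬ 2 ∣ suc (value j₁) → value j₁ < value j₂ → ⊥
    no-ascent-after-top {p} {j₁} {j₂} vp≡top j₁≡1+p j₂≡1+j₁ j₂<K vj₁<top odd vj₁<vj₂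
      with suc (value j₁) ≟ top
    ... | yes 1+vj₁≡top = <⇒≱ vj₁<vj₂ (≤-pred (subst (value j₂ <_) (sym 1+vj₁≡top) vj₂<top))
      where
      vj₂≢top : value j₂ ≢ top
      vj₂≢top vj₂≡top = <-irrefl (cong toℕ (sym (value-injective (trans vj₂≡top (sym vp≡top)))))
                                 (<-trans (≡suc⇒> j₁≡1+p) (≡suc⇒> j₂≡1+j₁))
      vj₂<top : value j₂ < top
      vj₂<top = ≤∧≢⇒< (≤-pred (value<K j₂ j₂<K)) vj₂≢top
    ... | no 1+vj₁≢top =
      let (r , vr≡1+vj₁ , j₁<r) = successor-position vp≡top j₁≡1+p (≤∧≢⇒< vj₁<top 1+vj₁≢top)
      in no-ascent-before-successor j₂≡1+j₁ j₁<r vr≡1+vj₁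
           (subst (λ v → 2 ∣ suc v) (sym vr≡1+vj₁) (2∤n⇒2∣1+n odd)) vj₁<vj₂

    no-gap-after-top : ∀ {p j₁} → value p ≡ top → toℕ j₁ ≡ suc (toℕ p) → value j₁ < top →
      suc (toℕ j₁) < suc top → ⊥
    no-gap-after-top {p} {j₁} vp≡top j₁≡1+p vj₁<top j₁+1<K with 2 ∣? suc (value j₁)
    ... | yes even =
      let (j₂ , j₂≡1+j₁ , vj₂<vj₁) = descent j₁ even
      in no-descent-after-top vp≡top j₁≡1+p j₂≡1+j₁ vj₁<top even vj₂<vj₁
    ... | no odd =
      let (j₂ , j₂≡1+j₁ , vj₁<vj₂) = ascent j₁ odd (<-≤-trans j₁+1<K K≤m)
      in no-ascent-after-top vp≡top j₁≡1+p j₂≡1+j₁ (subst (_< suc top) (sym j₂≡1+j₁) j₁+1<K)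
           vj₁<top odd vj₁<vj₂

    topPosition : Fin m
    topPosition = position top top<m

    value-topPosition : value topPosition ≡ top
    value-topPosition = value-position top<m

    topPosition≡double : toℕ topPosition ≡ double k
    topPosition≡double =
      let (j₁ , j₁≡1+p , vj₁<vp) =
            descent topPosition (subst (λ v → 2 ∣ suc v) (sym value-topPosition) (2∣double (suc k)))
          vj₁<top = subst (value j₁ <_) value-topPosition vj₁<vp
          j₁<K = index<K j₁ (<-trans vj₁<top (n<1+n top))
          p≤2k = ≤-pred (≤-pred (subst (_< suc top) j₁≡1+p j₁<K))
          p≮2k : ¬ toℕ topPosition < double k
          p≮2k = λ p<2k → no-gap-after-top value-topPosition j₁≡1+p vj₁<top
                            (subst (λ x → suc x < suc top) (sym j₁≡1+p) (s<s (s<s p<2k)))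
      in ≤-antisym p≤2k (≮⇒≥ p≮2k)

    value-at-double : ∀ i → toℕ i ≡ double k → value i ≡ top
    value-at-double i i≡2k =
      trans (value-cong (trans i≡2k (sym topPosition≡double))) value-topPosition

    value-at-top : ∀ q → toℕ q ≡ top → value q ≡ double k
    value-at-top q q≡top with <-cmp (value q) (double k)
    ... | tri≈ _ vq≡2k _ = vq≡2k
    ... | tri> _ _ 2k<vq =
      ⊥-elim (1+n≢n (trans (sym q≡top) (trans (cong toℕ q≡p) topPosition≡double)))
      where
      vq≤top : value q ≤ top
      vq≤top = ≤-pred (value<K q (subst (_< suc top) (sym q≡top) (n<1+n top)))
      q≡p : q ≡ topPosition
      q≡p = value-injective (trans (≤-antisym vq≤top 2k<vq) (sym value-topPosition))
    ... | tri< vq<2k _ _ =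
      ⊥-elim (<-irrefl (trans (value-cong (trans q≡top (sym r≡top))) vr≡2k) vq<2k)
      where
      2k<m : double k < m
      2k<m = <-trans (n<1+n (double k)) top<m
      r : Fin m
      r = position (double k) 2k<m
      vr≡2k : value r ≡ double k
      vr≡2k = value-position 2k<m
      p<r : toℕ topPosition < toℕ r
      p<r = between⇒right (subst₂ _<_ (sym topPosition≡double) (sym q≡top) (n<1+n (double k)))
                          (subst (value q <_) (sym vr≡2k) vq<2k)
                          (subst₂ _<_ (sym vr≡2k) (sym value-topPosition) (n<1+n (double k)))
      r<K : toℕ r < suc top
      r<K = index<K r (subst (_< suc top) (sym vr≡2k) (<-trans (n<1+n (double k)) (n<1+n top)))
      r≡top : toℕ r ≡ top
      r≡top = ≤-antisym (≤-pred r<K) (subst (_< toℕ r) topPosition≡double p<r)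

  module _ {n} (m≡double : m ≡ double n) where

    agreesFrom-step : ∀ {k} → suc k ≤ n → AgreesFrom π (double (suc k)) → AgreesFrom π (double k)
    agreesFrom-step {k} k<n agrees = agreesFrom-extend k value-at-double value-at-top agrees
      where
      open Block k (subst (double (suc k) ≤_) (sym m≡double) (double-mono k<n))
                   (agreesFrom⇒prefixInvariant m≡double π-injective agrees)

    agreesFrom-double : ∀ d {k} → d + k ≡ n → AgreesFrom π (double k)
    agreesFrom-double zero refl i 2n≤i =
      contradiction (subst (toℕ i <_) m≡double (toℕ<n i)) (≤⇒≯ 2n≤i)
    agreesFrom-double (suc d) {k} 1+d+k≡n =
      agreesFrom-step (subst (suc k ≤_) d+1+k≡n (m≤n+m (suc k) d)) (agreesFrom-double d d+1+k≡n)
      where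
      d+1+k≡n : d + suc k ≡ n
      d+1+k≡n = trans (+-suc d k) 1+d+k≡n

    π≗swapAdj : ∀ i → toℕ (π i) ≡ swapAdj (toℕ i)
    π≗swapAdj i = agreesFrom-double n (+-identityʳ n) i z≤n

theorem3p8 : (n : ℕ) → 1 ≤ n → (π : Fin (2 * n) → Fin (2 * n)) →
    InD1-231-4213 n π ⇔ (∀ i → toℕ (π i) ≡ swapAdj (toℕ i))
theorem3p8 n _ π = mk⇔ hard easy
  where
  2n≡double : 2 * n ≡ double n
  2n≡double = sym (double≡2* n)
  hard : InD1-231-4213 n π → ∀ i → toℕ (π i) ≡ swapAdj (toℕ i)
  hard (π-injective , π-dumont , avoids231 , avoids4213) =
    Avoiding.π≗swapAdj π-injective π-dumont avoids231 avoids4213 2n≡double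
  easy : (∀ i → toℕ (π i) ≡ swapAdj (toℕ i)) → InD1-231-4213 n π
  easy π≗swapAdj = swapAdj-isPerm π≗swapAdj , swapAdj-isDumont1 π≗swapAdj 2n≡double ,
                   swapAdj-avoids231 π≗swapAdj , swapAdj-avoids4213 π≗swapAdj
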